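{- Let $k$ be an odd positive integer. Then $S_3(k;k)\ge 2(k^2-k-1)$.
   Context: For positive integers $k,r$ with $r\mid k$: a solution to $\mathcal{E}$ is a $k$-tuple $(x_1,\dots,x_k)$ of positive integers (not necessarily distinct) with $\sum_{i=1}^{k-1}x_i=x_k$. Given a coloring $\chi$ of a set of positive integers by non-negative integers, a solution is called $r$-zero-sum if $\sum_{i=1}^k\chi(x_i)\equiv 0\pmod r$. $S_3(k;r)$ denotes the minimum positive integer $n$ such that every coloring $\chi:\{1,\dots,n\}\to\{0,1,\dots,r-1\}$ admits an $r$-zero-sum solution to $\mathcal{E}$ with all $x_i\in\{1,\dots,n\}$ (and $\infty$ if no such $n$ exists). -}

module Defs where

open import Data.Nat using (ℕ; zero; suc; _+_; _*_; _∸_; _≤_; _<_)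
open import Data.Nat.Divisibility using (_∣_)
open import Data.Fin using (Fin; toℕ)
open import Data.Vec using (Vec; map; sum)
open import Data.Vec.Relation.Unary.All using (All)
open import Data.Product using (Σ; _×_; ∃)
open import Relation.Nullary using (¬_)
open import Relation.Binary.PropositionalEquality using (_≡_)

InRange : ℕ → ℕ → Set
InRange n x = (1 ≤ x) × (x ≤ n)

-- A k-tuple (x₁,…,x_{k-1}, x_k) (for k ≥ 1) is represented as the vector xs
-- of its first k-1 entries together with its last entry y.
record Solution (k n : ℕ) : Set where
  constructor sol
  field
    xs    : Vec ℕ (k ∸ 1)
    y     : ℕ
    xs-in : All (InRange n) xs
    y-in  : InRange n y
    eqn   : sum xs ≡ y

open Solution public

-- A coloring χ of {1,…,n} with colors {0,…,r-1}; only the values on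
-- {1,…,n} matter (solutions only use entries in {1,…,n}).
Coloring : ℕ → Set
Coloring r = ℕ → Fin r

ZeroSum : (r : ℕ) → Coloring r → {k n : ℕ} → Solution k n → Set
ZeroSum r χ s = r ∣ (sum (map (λ x → toℕ (χ x)) (xs s)) + toℕ (χ (y s)))

Forces : (k r n : ℕ) → Set
Forces k r n = (χ : Coloring r) → Σ (Solution k n) (ZeroSum r χ)

-- S₃(k;r) ≥ N : S₃(k;r) is the least positive n with Forces k r n (or ∞),
-- so S₃(k;r) ≥ N means no positive n < N has that property.
S₃≥ : (k r N : ℕ) → Set
S₃≥ k r N = (n : ℕ) → 1 ≤ n → n < N → ¬ Forces k r n

module Submission where

-- Write k = l + 1, so a solution consists of l summands x₁,…,x_l and their
-- sum y.  For k ≥ 3 colour x ∈ ℕ by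
--     1  if x is odd,
--     2  if x is even and 2l ≤ x < 2l²,
--     0  otherwise,
-- so that every colour has the parity of its argument.  For a solution the
-- colour sum S then has the parity of x₁ + … + x_l + y = 2y, i.e. S is even;
-- as 0 ≤ S ≤ 2k and k is odd, a zero-sum solution has S = 0 or S = 2k, so
-- all its k colours are 0, or all are 2.
--  * All 2: every xᵢ ≥ 2l, so y ≥ 2l², contradicting y < 2l².
--  * All 0: all entries are even, so xᵢ ≥ 2 and y ≥ 2l, hence y ≥ 2l².
--    If every xᵢ < 2l then y < 2l², so some xᵢ ≥ 2l² and
--    y ≥ 2l² + 2(l - 1) = 2(k² - k - 1), outside {1,…,n} for n < 2(k²-k-1).

open import Defs
open import Data.Nat using (ℕ; zero; suc; _+_; _*_; _∸_; _≤_; _<_; _≤?_; _<?_; z≤n; s≤s)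
open import Data.Nat.Properties
open import Data.Nat.Divisibility using (_∣_; divides; ∣-refl; ∣⇒≤; ∣m∣n⇒∣m+n; ∣m+n∣m⇒∣n)
open import Data.Nat.Solver using (module +-*-Solver)
open import Data.Fin using (Fin; toℕ) renaming (zero to fzero; suc to fsuc)
open import Data.Vec using (Vec; []; _∷_; map; sum)
open import Data.Vec.Relation.Unary.All as All using (All; []; _∷_)
open import Data.Vec.Relation.Unary.All.Properties using (map⁺; map⁻)
open import Data.Vec.Relation.Unary.Any using (Any; here; there)
open import Data.Product using (_×_; _,_; proj₁; proj₂)
open import Data.Sum using (_⊎_; inj₁; inj₂)
open import Data.Empty using (⊥)
open import Relation.Nullary using (¬_; yes; no; contradiction)
open import Relation.Binary.PropositionalEquality using (_≡_; refl; sym; trans; cong; subst; module ≡-Reasoning)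
open import Algebra.Properties.CommutativeSemigroup +-commutativeSemigroup using (x∙yz≈y∙xz)

sum-≥ : ∀ {n a} {xs : Vec ℕ n} → All (a ≤_) xs → n * a ≤ sum xs
sum-≥ []         = z≤n
sum-≥ (px ∷ pxs) = +-mono-≤ px (sum-≥ pxs)

sum-≤ : ∀ {n b} {xs : Vec ℕ n} → All (_≤ b) xs → sum xs ≤ n * b
sum-≤ []         = z≤n
sum-≤ (px ∷ pxs) = +-mono-≤ px (sum-≤ pxs)

sum-< : ∀ {n b} {xs : Vec ℕ (suc n)} → All (_< b) xs → sum xs < suc n * b
sum-< {zero}  (px ∷ [])  = +-mono-<-≤ px z≤n
sum-< {suc n} (px ∷ pxs) = +-mono-<-≤ px (<⇒≤ (sum-< pxs))

sum≡0 : ∀ {n} {xs : Vec ℕ n} → sum xs ≡ 0 → All (_≡ 0) xs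
sum≡0 {xs = []}     _  = []
sum≡0 {xs = x ∷ xs} eq = m+n≡0⇒m≡0 x eq ∷ sum≡0 (m+n≡0⇒n≡0 x eq)

sum-maximal : ∀ {n b} {xs : Vec ℕ n} → All (_≤ b) xs → n * b ≤ sum xs → All (_≡ b) xs
sum-maximal []                              _     = []
sum-maximal {suc n} {b} {x ∷ xs} (px ∷ pxs) total =
  ≤-antisym px head-max ∷ sum-maximal pxs tail-max
  where
  head-max : b ≤ x
  head-max = +-cancelʳ-≤ (n * b) b x (≤-trans total (+-monoʳ-≤ x (sum-≤ pxs)))
  tail-max : n * b ≤ sum xs
  tail-max = +-cancelˡ-≤ b (n * b) (sum xs) (≤-trans total (+-monoˡ-≤ (sum xs) px))

sum-any-≥ : ∀ {n a B} {xs : Vec ℕ (suc n)} → All (a ≤_) xs → Any (B ≤_) xs → B + n * a ≤ sum xs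
sum-any-≥ (_  ∷ pxs) (here big) = +-mono-≤ big (sum-≥ pxs)
sum-any-≥ {suc n} {a} {B} (px ∷ pxs) (there big) = begin
  B + (a + n * a)   ≡⟨ x∙yz≈y∙xz B a (n * a) ⟩
  a + (B + n * a)   ≤⟨ +-mono-≤ px (sum-any-≥ pxs big) ⟩
  _                 ∎
  where open ≤-Reasoning

all-or-any : ∀ {n} {P Q : ℕ → Set} {xs : Vec ℕ n} → All (λ x → P x ⊎ Q x) xs → All P xs ⊎ Any Q xs
all-or-any []              = inj₁ []
all-or-any (inj₂ q ∷ _)    = inj₂ (here q)
all-or-any (inj₁ p ∷ pqxs) with all-or-any pqxs
... | inj₁ ps = inj₁ (p ∷ ps)
... | inj₂ q  = inj₂ (there q)

even-or-odd : ∀ x → 2 ∣ x ⊎ 2 ∣ suc x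
even-or-odd zero    = inj₁ (divides 0 refl)
even-or-odd (suc x) with even-or-odd x
... | inj₁ even-x = inj₂ (∣m∣n⇒∣m+n ∣-refl even-x)
... | inj₂ odd-x  = inj₁ odd-x

module _ (f : ℕ → ℕ) (same-parity : ∀ x → 2 ∣ f x + x) where
  open +-*-Solver

  sum-same-parity : ∀ {n} (xs : Vec ℕ n) → 2 ∣ sum (map f xs) + sum xs
  sum-same-parity []       = divides 0 refl
  sum-same-parity (x ∷ xs) =
    subst (2 ∣_) (solve 4 (λ a b p q → (a :+ b) :+ (p :+ q) := (a :+ p) :+ (b :+ q)) refl
                          (f x) x (sum (map f xs)) (sum xs))
          (∣m∣n⇒∣m+n (same-parity x) (sum-same-parity xs))

  -- On a solution x₁ + … + x_l = y the total f(y) + Σ f(xᵢ) is even, since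
  -- its parity is that of y + Σ xᵢ = 2y.
  solution-sum-even : ∀ {n} (xs : Vec ℕ n) y → sum xs ≡ y → 2 ∣ sum (map f (y ∷ xs))
  solution-sum-even xs y refl = ∣m+n∣m⇒∣n total-with-2y (divides (sum xs) (*-comm 2 (sum xs)))
    where
    s : ℕ
    s = sum xs
    total-with-2y : 2 ∣ 2 * s + sum (map f (s ∷ xs))
    total-with-2y =
      subst (2 ∣_) (solve 3 (λ fs fy t → (fs :+ t) :+ (fy :+ t) := con 2 :* t :+ (fy :+ fs)) refl
                           (sum (map f xs)) (f s) s)
            (∣m∣n⇒∣m+n (sum-same-parity xs) (same-parity s))

even-multiple-of-odd : ∀ {k S} → ¬ 2 ∣ k → k ∣ S → 2 ∣ S → S ≤ k * 2 → S ≡ 0 ⊎ S ≡ k * 2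
even-multiple-of-odd odd-k (divides 0 eq) _ _ = inj₁ eq
even-multiple-of-odd {k} odd-k (divides 1 eq) even-S _ =
  contradiction (subst (2 ∣_) (trans eq (+-identityʳ k)) even-S) odd-k
even-multiple-of-odd {k} odd-k (divides 2 eq) _ _ = inj₂ (trans eq (*-comm 2 k))
even-multiple-of-odd {zero}  odd-k (divides (suc (suc (suc q))) eq) _ _ = contradiction (divides 0 refl) odd-k
even-multiple-of-odd {suc k} {S} odd-k (divides (suc (suc (suc q))) eq) _ S≤2k =
  contradiction (≤-trans triple≤S S≤2k) (<⇒≱ double<triple)
  where
  triple≤S : 3 * suc k ≤ S
  triple≤S = subst (3 * suc k ≤_) (sym eq) (*-monoˡ-≤ (suc k) {3} {3 + q} (s≤s (s≤s (s≤s z≤n))))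
  double<triple : suc k * 2 < 3 * suc k
  double<triple = subst (_< 3 * suc k) (*-comm 2 (suc k)) (*-monoˡ-< (suc k) {2} {3} ≤-refl)

module Colouring (j : ℕ) where
  k l lo top N : ℕ
  k   = 3 + j
  l   = 2 + j
  lo  = l * 2
  top = l * lo
  -- smallest possible y of a solution whose colours are all 0
  N   = top + suc j * 2

  data Kind (x : ℕ) : Set where
    odd   : 2 ∣ suc x → Kind x
    inner : 2 ∣ x → lo ≤ x → x < top → Kind x
    outer : 2 ∣ x → x < lo ⊎ top ≤ x → Kind x

  kind : ∀ x → Kind x
  kind x with even-or-odd x | lo ≤? x | x <? top
  ... | inj₂ odd-x  | _       | _        = odd odd-x
  ... | inj₁ even-x | yes ≥lo | yes <top = inner even-x ≥lo <top
  ... | inj₁ even-x | yes _   | no ≮top  = outer even-x (inj₂ (≮⇒≥ ≮top))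
  ... | inj₁ even-x | no ≱lo  | _        = outer even-x (inj₁ (≰⇒> ≱lo))

  kind-colour : ∀ {x} → Kind x → Fin k
  kind-colour (odd _)       = fsuc fzero
  kind-colour (inner _ _ _) = fsuc (fsuc fzero)
  kind-colour (outer _ _)   = fzero

  χ : Coloring k
  χ x = kind-colour (kind x)

  colour : ℕ → ℕ
  colour x = toℕ (χ x)

  colour-parity : ∀ x → 2 ∣ colour x + x
  colour-parity x = by-kind (kind x)
    where
    by-kind : (κ : Kind x) → 2 ∣ toℕ (kind-colour κ) + x
    by-kind (odd odd-x)         = odd-x
    by-kind (inner even-x _ _)  = ∣m∣n⇒∣m+n ∣-refl even-x
    by-kind (outer even-x _)    = even-x

  colour-≤2 : ∀ x → colour x ≤ 2
  colour-≤2 x = by-kind (kind x)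
    where
    by-kind : (κ : Kind x) → toℕ (kind-colour κ) ≤ 2
    by-kind (odd _)       = s≤s z≤n
    by-kind (inner _ _ _) = ≤-refl
    by-kind (outer _ _)   = z≤n

  colour-0 : ∀ x → colour x ≡ 0 → 1 ≤ x → 2 ≤ x × (x < lo ⊎ top ≤ x)
  colour-0 x = by-kind (kind x)
    where
    by-kind : (κ : Kind x) → toℕ (kind-colour κ) ≡ 0 → 1 ≤ x → 2 ≤ x × (x < lo ⊎ top ≤ x)
    by-kind (outer even-x range) _ (s≤s _) = ∣⇒≤ even-x , range

  colour-2 : ∀ x → colour x ≡ 2 → lo ≤ x × x < top
  colour-2 x = by-kind (kind x)
    where
    by-kind : (κ : Kind x) → toℕ (kind-colour κ) ≡ 2 → lo ≤ x × x < top
    by-kind (inner _ ≥lo <top) _ = ≥lo , <top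

  -- No solution has all colours 2: then y = Σ xᵢ ≥ l · lo = top.
  no-all-2 : ∀ {n} (s : Solution k n) → ¬ All (λ x → colour x ≡ 2) (y s ∷ xs s)
  no-all-2 (sol xs y _ _ refl) (y-2 ∷ xs-2) =
    <⇒≱ (proj₂ (colour-2 y y-2)) (sum-≥ (All.map (λ {x} e → proj₁ (colour-2 x e)) xs-2))

  no-all-0 : ∀ {n} → n < N → (s : Solution k n) → ¬ All (λ x → colour x ≡ 0) (y s ∷ xs s)
  no-all-0 n<N (sol xs y xs-in (y≥1 , y≤n) refl) (y-0 ∷ xs-0) =
    by-cases (proj₂ (colour-0 y y-0 y≥1)) (all-or-any (All.map proj₂ entries))
    where
    entries : All (λ x → 2 ≤ x × (x < lo ⊎ top ≤ x)) xs
    entries = All.map (λ {x} (x-0 , x-in) → colour-0 x x-0 (proj₁ x-in)) (All.zip (xs-0 , xs-in))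
    y≥lo : lo ≤ y
    y≥lo = sum-≥ (All.map proj₁ entries)
    by-cases : (y < lo ⊎ top ≤ y) → All (_< lo) xs ⊎ Any (top ≤_) xs → ⊥
    by-cases (inj₁ y<lo) _                  = <⇒≱ y<lo y≥lo
    by-cases (inj₂ y≥top) (inj₁ all-small)  = <⇒≱ (sum-< all-small) y≥top
    by-cases (inj₂ _)     (inj₂ one-big)    =
      <⇒≱ n<N (≤-trans (sum-any-≥ (All.map proj₁ entries) one-big) y≤n)

  no-zero-sum : ¬ 2 ∣ k → ∀ {n} → n < N → (s : Solution k n) → ¬ ZeroSum k χ s
  no-zero-sum odd-k n<N s zero-sum = by-cases (even-multiple-of-odd odd-k k∣S S-even S≤2k)
    where
    colours : Vec ℕ k
    colours = map colour (y s ∷ xs s)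
    colours-≤2 : All (_≤ 2) colours
    colours-≤2 = map⁺ (All.universal colour-≤2 (y s ∷ xs s))
    k∣S : k ∣ sum colours
    k∣S = subst (k ∣_) (+-comm (sum (map colour (xs s))) (colour (y s))) zero-sum
    S-even : 2 ∣ sum colours
    S-even = solution-sum-even colour colour-parity (xs s) (y s) (eqn s)
    S≤2k : sum colours ≤ k * 2
    S≤2k = sum-≤ colours-≤2
    by-cases : sum colours ≡ 0 ⊎ sum colours ≡ k * 2 → ⊥
    by-cases (inj₁ S≡0)  = no-all-0 n<N s (map⁻ (sum≡0 S≡0))
    by-cases (inj₂ S≡2k) = no-all-2 s (map⁻ (sum-maximal colours-≤2 (≤-reflexive (sym S≡2k))))

  N≡bound : 2 * (k * k ∸ k ∸ 1) ≡ N
  N≡bound = begin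
    2 * (k * k ∸ k ∸ 1)          ≡⟨ cong (λ t → 2 * (t ∸ 1)) (m+n∸m≡n k (l * k)) ⟩
    2 * (l * k ∸ 1)              ≡⟨ solve 1 (λ j → con 2 :* (con 2 :+ j :+ (con 1 :+ j) :* (con 3 :+ j))
                                               := (con 2 :+ j) :* ((con 2 :+ j) :* con 2) :+ (con 1 :+ j) :* con 2) refl j ⟩
    N                            ∎
    where
    open ≡-Reasoning
    open +-*-Solver

-- k = 0, 2 are even and for k = 1 the bound is 0; otherwise use the colouring.
proposition7 : (k : ℕ) → ¬ (2 ∣ k) → S₃≥ k k (2 * (k * k ∸ k ∸ 1))
proposition7 0 odd-k = contradiction (divides 0 refl) odd-k
proposition7 1 odd-k n _ ()
proposition7 2 odd-k = contradiction (divides 1 refl) odd-k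
proposition7 (suc (suc (suc j))) odd-k n _ n<bound forces =
  no-zero-sum odd-k (subst (n <_) N≡bound n<bound) (proj₁ (forces χ)) (proj₂ (forces χ))
  where open Colouring j
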